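{- A tournament $G$ has no subtournament isomorphic to $D_4$ if and only if $G$ is isomorphic to $T_n(I^1,\dots,I^n)$ or to $I_2(T_n(I^1,\dots,I^n),I)$, where $n\ge 1$ is odd, $I_2$ is taken with its standard ordering, and $I^1,\dots,I^n,I$ are transitive tournaments.
   Context: A tournament has exactly one directed edge between any two distinct vertices. $D_4$ is the 4-vertex tournament consisting of a cyclic triangle $C$ and a vertex $v$ with $v\to c$ for all $c\in C$. A tournament is transitive if its vertices can be ordered $v_1,\dots,v_n$ (the standard ordering) with $v_i\to v_j$ whenever $i<j$; $I_m$ denotes the transitive tournament on $m$ vertices. For odd $n=2k+1$, $T_n$ has vertices $v_1,\dots,v_n$ with $v_i\to v_j$ iff $j\equiv i+1,\dots,i+k\pmod n$ ($T_1$ is a single vertex). Substitution: given a tournament $G$ with vertex ordering $v_1,\dots,v_n$ and tournaments $H_1,\dots,H_n$, $G(H_1,\dots,H_n)$ is a tournament whose vertex set is a disjoint union $V_1\cup\dots\cup V_n$ with the subtournament on $V_i$ isomorphic to $H_i$, and with $x\to y$ for all $x\in V_i,y\in V_j$ whenever $v_i\to v_j$ in $G$ ($i\ne j$). -}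

module Defs where

open import Data.Nat using (ℕ; zero; suc; _+_; _*_; _∸_; _≤ᵇ_; _<ᵇ_)
open import Data.Nat.DivMod using (_%_)
open import Data.Fin using (Fin; zero; suc; toℕ; _<_; _≟_)
open import Data.Bool using (Bool; true; false; not; _∧_)
open import Data.Product using (Σ; Σ-syntax; _×_; _,_)
open import Relation.Binary.PropositionalEquality using (_≡_; _≢_; refl)
open import Relation.Nullary using (yes; no)
open import Function.Bundles using (_↔_; Inverse)
open import Function.Definitions using (Injective)

record Digraph : Set₁ where
  field
    Carrier : Set
    adj     : Carrier → Carrier → Bool
open Digraph public

IsTournament : Digraph → Set
IsTournament G =
  (∀ x → adj G x x ≡ false) ×
  (∀ x y → x ≢ y → adj G y x ≡ not (adj G x y))

finDigraph : (N : ℕ) → (Fin N → Fin N → Bool) → Digraph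
finDigraph N a = record { Carrier = Fin N ; adj = a }

record _≅_ (G H : Digraph) : Set where
  field
    bij  : Carrier G ↔ Carrier H
    pres : ∀ x y → adj H (Inverse.to bij x) (Inverse.to bij y) ≡ adj G x y

HasSubIso : Digraph → Digraph → Set
HasSubIso G D =
  Σ[ f ∈ (Carrier D → Carrier G) ]
    (Injective _≡_ _≡_ f × (∀ x y → adj G (f x) (f y) ≡ adj D x y))

IsTransitive : Digraph → Set
IsTransitive H =
  Σ[ m ∈ ℕ ] Σ[ σ ∈ (Fin m ↔ Carrier H) ]
    (∀ i j → i < j → adj H (Inverse.to σ i) (Inverse.to σ j) ≡ true)

-- A (nonempty) transitive tournament.
TransitiveTournament : Digraph → Set
TransitiveTournament H = IsTournament H × IsTransitive H × Carrier H

D4adj : Fin 4 → Fin 4 → Bool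
D4adj zero (suc _) = true
D4adj (suc zero) (suc (suc zero)) = true
D4adj (suc (suc zero)) (suc (suc (suc zero))) = true
D4adj (suc (suc (suc zero))) (suc zero) = true
D4adj _ _ = false

D4 : Digraph
D4 = finDigraph 4 D4adj

-- T_n for n = 2k+1 (vertices indexed 0..n-1):
-- vᵢ → vⱼ iff j ≡ i + d (mod n) for some d ∈ {1,…,k}.
Tadj : (k : ℕ) → Fin (suc (2 * k)) → Fin (suc (2 * k)) → Bool
Tadj k i j = (1 ≤ᵇ d) ∧ (d ≤ᵇ k)
  where
    n = suc (2 * k)
    d = (toℕ j + n ∸ toℕ i) % n

I2adj : Fin 2 → Fin 2 → Bool
I2adj i j = toℕ i <ᵇ toℕ j

subst : (n : ℕ) → (Fin n → Fin n → Bool) → (Fin n → Digraph) → Digraph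
subst n g H = record { Carrier = Σ (Fin n) (λ i → Carrier (H i)) ; adj = a }
  where
    a : Σ (Fin n) (λ i → Carrier (H i)) → Σ (Fin n) (λ i → Carrier (H i)) → Bool
    a (i , x) (j , y) with i ≟ j
    ... | yes refl = adj (H i) x y
    ... | no _ = g i j

pair : Digraph → Digraph → Fin 2 → Digraph
pair A B zero = A
pair A B (suc _) = B

TSubst : (k : ℕ) → (Fin (suc (2 * k)) → Digraph) → Digraph
TSubst k I = subst (suc (2 * k)) (Tadj k) I

I2Subst : Digraph → Digraph → Digraph
I2Subst A B = subst 2 I2adj (pair A B)

-- A tournament contains D₄ exactly when some out-neighbourhood contains a cyclic triangle, so
-- D₄-freeness says that all out-neighbourhoods are transitive.
--
-- T_n(I¹,…,Iⁿ) has this property: the out-neighbours of a vertex in block i lie in blocks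
-- i, i+1, …, i+k, and along an edge between two of these blocks the offset from i strictly
-- increases, so a cyclic triangle among them would lie in a single, transitive, block. The
-- extra block I of I₂(T_n(…), I) is dominated by all other vertices and is transitive itself.
--
-- Conversely, let G be D₄-free. A sink of G can be added to the block I of a decomposition of
-- the rest, and of two clones v → w (vertices related in the same way to all others) w can be
-- added to the block of v; so by induction G may be assumed to have neither. Let next x be the
-- source of the out-neighbourhood of x. A cyclic triangle has no common out-neighbour, since
-- the out-neighbours of a sink among them would again be common out-neighbours; hence the
-- out-neighbours of x are next x, next² x, …, next^d x in this order, d the out-degree of x.
-- Without clones the out-degree does not decrease along next. Following the orbit of a vertex
-- y₀ of out-degree D then shows that it has length 2D+1 and contains every vertex, and the
-- position on this orbit identifies G with T_{2D+1}.

module Submission where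

open import Defs
open import Axiom.UniquenessOfIdentityProofs using (module Decidable⇒UIP)
open import Data.Bool using (Bool; true; false; not; _∧_)
import Data.Bool.Properties as Bool
open import Data.Empty using (⊥; ⊥-elim)
open import Data.Fin using (Fin; zero; suc; toℕ; fromℕ<; _≟_; punchIn; punchOut)
import Data.Fin.Properties as Fin
open import Data.List using (List; []; _∷_; foldr; filter; allFin; length; lookup)
open import Data.List.Membership.Propositional using (_∈_)
open import Data.List.Membership.Propositional.Properties using (∈-allFin; ∈-filter⁺; ∈-filter⁻; ∈-lookup)
open import Data.List.Relation.Unary.All as All using (All)
open import Data.List.Relation.Unary.AllPairs as AllPairs using (AllPairs; []; _∷_)
open import Data.List.Relation.Unary.Any using (here; there; index)
open import Data.List.Relation.Unary.Any.Properties using (lookup-index)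
open import Data.Maybe using (Maybe; just; nothing; maybe; fromMaybe)
import Data.Maybe.Properties as Maybe
open import Data.Nat using (ℕ; zero; suc; _+_; _*_; _∸_; _≤_; _<_; z≤n; s≤s; NonZero; _≤ᵇ_)
import Data.Nat.Properties as ℕ
open import Algebra.Properties.CommutativeSemigroup ℕ.+-commutativeSemigroup using (xy∙z≈xz∙y)
open import Data.Nat.DivMod using (_%_; [m+n]%n≡m%n; m<n⇒m%n≡m)
open import Data.Product using (Σ; Σ-syntax; ∃; _×_; _,_; proj₁; proj₂)
open import Data.Sum using (_⊎_; inj₁; inj₂; [_,_]′)
open import Function using (_∘_; _on_; case_of_; flip; id)
open import Function.Bundles using (_↔_; mk↔ₛ′; Inverse; _⇔_; mk⇔; Equivalence)
open import Function.Properties.Inverse using (↔-trans)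
open import Relation.Binary using (DecidableEquality; tri<; tri≈; tri>)
open import Relation.Binary.PropositionalEquality hiding (subst; [_]; J)
import Relation.Binary.PropositionalEquality as ≡
open import Relation.Nullary using (¬_; Dec; yes; no; contradiction)
open import Relation.Nullary.Decidable
  using (from-yes; _⊎-dec_; _×-dec_; _→-dec_; ¬?; map′; decidable-stable; dec-true; dec-false)
open import Relation.Unary using (Decidable)

infix 4 _⊢_⟶_

_⊢_⟶_ : (G : Digraph) → Carrier G → Carrier G → Set
G ⊢ x ⟶ y = adj G x y ≡ true

Cyclic : (G : Digraph) → Carrier G → Carrier G → Carrier G → Set
Cyclic G x y z = G ⊢ x ⟶ y × G ⊢ y ⟶ z × G ⊢ z ⟶ x

rotate : ∀ {G x y z} → Cyclic G x y z → Cyclic G y z x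
rotate (x⟶y , y⟶z , z⟶x) = y⟶z , z⟶x , x⟶y

TriangleFree : (G : Digraph) → (Carrier G → Set) → Set
TriangleFree G P = ∀ {x y z} → P x → P y → P z → ¬ Cyclic G x y z

D4Free : Digraph → Set
D4Free G = ∀ t → TriangleFree G (G ⊢ t ⟶_)

module Tournament {G : Digraph} (isT : IsTournament G) where

  ⟶-irrefl : ∀ {x} → ¬ G ⊢ x ⟶ x
  ⟶-irrefl {x} x⟶x = Bool.not-¬ x⟶x (proj₁ isT x)

  ⟶⇒≢ : ∀ {x y} → G ⊢ x ⟶ y → x ≢ y
  ⟶⇒≢ x⟶x refl = ⟶-irrefl x⟶x

  ⟶-asym : ∀ {x y} → G ⊢ x ⟶ y → ¬ G ⊢ y ⟶ x
  ⟶-asym {x} {y} x⟶y = Bool.not-¬ (trans (proj₂ isT x y (⟶⇒≢ x⟶y)) (cong not x⟶y))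

  ¬⟶⇒⟵ : ∀ {x y} → x ≢ y → ¬ G ⊢ x ⟶ y → G ⊢ y ⟶ x
  ¬⟶⇒⟵ {x} {y} x≢y ¬x⟶y = trans (proj₂ isT x y x≢y) (cong not (Bool.¬-not ¬x⟶y))

  _⟶?_ : ∀ x y → Dec (G ⊢ x ⟶ y)
  x ⟶? y = adj G x y Bool.≟ true

-- D₄ as a pattern

D4Free-≅ : ∀ {G H} → G ≅ H → D4Free H → D4Free G
D4Free-≅ {G} {H} G≅H d4 t t⟶x t⟶y t⟶z (x⟶y , y⟶z , z⟶x) =
  d4 (to t) (map⟶ t⟶x) (map⟶ t⟶y) (map⟶ t⟶z) (map⟶ x⟶y , map⟶ y⟶z , map⟶ z⟶x)
  where
    open _≅_ G≅H
    open Inverse bij using (to)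
    map⟶ : ∀ {x y} → G ⊢ x ⟶ y → H ⊢ to x ⟶ to y
    map⟶ = trans (pres _ _)

HasSubIso-D4⇒¬D4Free : ∀ {G} → HasSubIso G D4 → ¬ D4Free G
HasSubIso-D4⇒¬D4Free (f , _ , pres) d4 =
  d4 (f zero) (pres zero 1F) (pres zero 2F) (pres zero 3F) (pres 1F 2F , pres 2F 3F , pres 3F 1F)
  where
    1F 2F 3F : Fin 4
    1F = suc zero
    2F = suc (suc zero)
    3F = suc (suc (suc zero))

edges⇒HasSubIso : ∀ {G H} → IsTournament G → IsTournament H → DecidableEquality (Carrier H) →
  (f : Carrier H → Carrier G) → (∀ {x y} → H ⊢ x ⟶ y → G ⊢ f x ⟶ f y) → HasSubIso G H
edges⇒HasSubIso {G} {H} isG isH _≟ᴴ_ f f⟶ = f , injective , preserves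
  where
    module G = Tournament isG
    module H = Tournament isH

    linked : ∀ {x y} → x ≢ y → H ⊢ x ⟶ y ⊎ H ⊢ y ⟶ x
    linked {x} {y} x≢y with x H.⟶? y
    ... | yes x⟶y = inj₁ x⟶y
    ... | no ¬x⟶y = inj₂ (H.¬⟶⇒⟵ x≢y ¬x⟶y)

    injective : ∀ {x y} → f x ≡ f y → x ≡ y
    injective {x} {y} fx≡fy with x ≟ᴴ y
    ... | yes x≡y = x≡y
    ... | no x≢y with linked x≢y
    ...   | inj₁ x⟶y = contradiction fx≡fy (G.⟶⇒≢ (f⟶ x⟶y))
    ...   | inj₂ y⟶x = contradiction (sym fx≡fy) (G.⟶⇒≢ (f⟶ y⟶x))

    preserves : ∀ x y → adj G (f x) (f y) ≡ adj H x y
    preserves x y with x ≟ᴴ y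
    ... | yes refl = trans (proj₁ isG (f x)) (sym (proj₁ isH x))
    ... | no x≢y with linked x≢y
    ...   | inj₁ x⟶y = trans (f⟶ x⟶y) (sym x⟶y)
    ...   | inj₂ y⟶x = trans (Bool.¬-not (G.⟶-asym (f⟶ y⟶x))) (sym (Bool.¬-not (H.⟶-asym y⟶x)))

D4-isTournament : IsTournament D4
D4-isTournament = irreflexive , antisymmetric
  where
    irreflexive : ∀ x → D4adj x x ≡ false
    irreflexive = from-yes (Fin.all? λ x → D4adj x x Bool.≟ false)
    oriented : ∀ x y → x ≡ y ⊎ D4adj y x ≡ not (D4adj x y)
    oriented = from-yes (Fin.all? λ x → Fin.all? λ y → (x ≟ y) ⊎-dec (D4adj y x Bool.≟ not (D4adj x y)))
    antisymmetric : ∀ x y → x ≢ y → D4adj y x ≡ not (D4adj x y)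
    antisymmetric x y x≢y with oriented x y
    ... | inj₁ x≡y = contradiction x≡y x≢y
    ... | inj₂ flipped = flipped

D4-pattern⇒HasSubIso : ∀ {G} → IsTournament G → ∀ {t x y z} →
  G ⊢ t ⟶ x → G ⊢ t ⟶ y → G ⊢ t ⟶ z → Cyclic G x y z → HasSubIso G D4
D4-pattern⇒HasSubIso {G} isG {t} {x} {y} {z} t⟶x t⟶y t⟶z (x⟶y , y⟶z , z⟶x) =
  edges⇒HasSubIso isG D4-isTournament _≟_ f f⟶
  where
    f : Fin 4 → Carrier G
    f zero = t
    f (suc zero) = x
    f (suc (suc zero)) = y
    f (suc (suc (suc zero))) = z
    f⟶ : ∀ {p q} → D4 ⊢ p ⟶ q → G ⊢ f p ⟶ f q
    f⟶ {zero} {suc zero} _ = t⟶x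
    f⟶ {zero} {suc (suc zero)} _ = t⟶y
    f⟶ {zero} {suc (suc (suc zero))} _ = t⟶z
    f⟶ {suc zero} {suc (suc zero)} _ = x⟶y
    f⟶ {suc (suc zero)} {suc (suc (suc zero))} _ = y⟶z
    f⟶ {suc (suc (suc zero))} {suc zero} _ = z⟶x
    f⟶ {zero} {zero} ()
    f⟶ {suc zero} {zero} ()
    f⟶ {suc (suc zero)} {zero} ()
    f⟶ {suc (suc (suc zero))} {zero} ()
    f⟶ {suc zero} {suc zero} ()
    f⟶ {suc zero} {suc (suc (suc zero))} ()
    f⟶ {suc (suc zero)} {suc zero} ()
    f⟶ {suc (suc zero)} {suc (suc zero)} ()
    f⟶ {suc (suc (suc zero))} {suc (suc zero)} ()
    f⟶ {suc (suc (suc zero))} {suc (suc (suc zero))} ()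

¬HasSubIso-D4⇔D4Free : ∀ {G} → IsTournament G → (¬ HasSubIso G D4) ⇔ D4Free G
¬HasSubIso-D4⇔D4Free {G} isG =
  mk⇔ (λ ¬D4 t {_} {_} {_} t⟶x t⟶y t⟶z cyc → ¬D4 (D4-pattern⇒HasSubIso isG t⟶x t⟶y t⟶z cyc))
      (λ d4 D4↪G → HasSubIso-D4⇒¬D4Free D4↪G d4)

-- T_n-blow-ups are D₄-free

transitive⇒acyclic : ∀ {H} → IsTournament H → IsTransitive H → ∀ {x y z} → ¬ Cyclic H x y z
transitive⇒acyclic {H} isH (m , σ , ordered) (x⟶y , y⟶z , z⟶x) =
  ℕ.<-irrefl refl (ℕ.<-trans (rank-< x⟶y) (ℕ.<-trans (rank-< y⟶z) (rank-< z⟶x)))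
  where
    open Tournament isH
    open Inverse σ
    rank-< : ∀ {p q} → H ⊢ p ⟶ q → toℕ (from p) < toℕ (from q)
    rank-< {p} {q} p⟶q with Fin.<-cmp (from p) (from q)
    ... | tri< lt _ _ = lt
    ... | tri≈ _ eq _ =
      ⊥-elim (⟶⇒≢ p⟶q (trans (sym (strictlyInverseˡ p)) (trans (cong to eq) (strictlyInverseˡ q))))
    ... | tri> _ _ gt =
      ⊥-elim (⟶-asym p⟶q (subst₂ (H ⊢_⟶_) (strictlyInverseˡ q) (strictlyInverseˡ p) (ordered _ _ gt)))

TransitiveTournament⇒acyclic : ∀ {H} → TransitiveTournament H → ∀ {x y z} → ¬ Cyclic H x y z
TransitiveTournament⇒acyclic (isH , trH , _) = transitive⇒acyclic isH trH

subst-adj-within : ∀ {n g} {H : Fin n → Digraph} i x y → adj (subst n g H) (i , x) (i , y) ≡ adj (H i) x y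
subst-adj-within i x y with i ≟ i
... | yes refl = refl
... | no i≢i = contradiction refl i≢i

-- Steps n i j d: going d steps around the n-cycle from i lands on j.
Steps : ℕ → ℕ → ℕ → ℕ → Set
Steps n i j d = d < n × (i + d ≡ j ⊎ i + d ≡ j + n)

steps-% : ∀ n .{{_ : NonZero n}} {i j} → i < n → j < n → Steps n i j ((j + n ∸ i) % n)
steps-% n {i} {j} i<n j<n with i ℕ.≤? j
... | yes i≤j = ≡.subst (Steps n i j) (sym distance≡) (j∸i<n , inj₁ (ℕ.m+[n∸m]≡n i≤j))
  where
    j∸i<n : j ∸ i < n
    j∸i<n = ℕ.≤-<-trans (ℕ.m∸n≤m j i) j<n
    distance≡ : (j + n ∸ i) % n ≡ j ∸ i
    distance≡ = begin
      (j + n ∸ i) % n  ≡⟨ cong (_% n) (ℕ.+-∸-comm n i≤j) ⟩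
      (j ∸ i + n) % n  ≡⟨ [m+n]%n≡m%n (j ∸ i) n ⟩
      (j ∸ i) % n      ≡⟨ m<n⇒m%n≡m j∸i<n ⟩
      j ∸ i            ∎
      where open ≡-Reasoning
... | no i≰j = ≡.subst (Steps n i j) (sym (m<n⇒m%n≡m j+n∸i<n)) (j+n∸i<n , inj₂ (ℕ.m+[n∸m]≡n i≤j+n))
  where
    i≤j+n : i ≤ j + n
    i≤j+n = ℕ.≤-trans (ℕ.<⇒≤ i<n) (ℕ.m≤n+m n j)
    j+n∸i<n : j + n ∸ i < n
    j+n∸i<n =
      ≡.subst (j + n ∸ i <_) (ℕ.m+n∸m≡n i n) (ℕ.∸-monoˡ-< (ℕ.+-monoˡ-< n (ℕ.≰⇒> i≰j)) i≤j+n)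

steps-unique : ∀ {n i j d d′} → Steps n i j d → Steps n i j d′ → d ≡ d′
steps-unique {n} {i} (_ , inj₁ e) (_ , inj₁ e′) = ℕ.+-cancelˡ-≡ i _ _ (trans e (sym e′))
steps-unique {n} {i} (_ , inj₂ e) (_ , inj₂ e′) = ℕ.+-cancelˡ-≡ i _ _ (trans e (sym e′))
steps-unique {n} {i} (_ , inj₁ e) (d′<n , inj₂ e′) = contradiction (overshoot e e′) (ℕ.<⇒≱ d′<n)
  where
    overshoot : ∀ {j d d′} → i + d ≡ j → i + d′ ≡ j + n → n ≤ d′
    overshoot {j} {d} {d′} e e′ = ≡.subst (n ≤_) (ℕ.+-cancelˡ-≡ i (d + n) d′ (begin
      i + (d + n)  ≡⟨ sym (ℕ.+-assoc i d n) ⟩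
      i + d + n    ≡⟨ cong (_+ n) e ⟩
      j + n        ≡⟨ sym e′ ⟩
      i + d′       ∎)) (ℕ.m≤n+m n d)
      where open ≡-Reasoning
steps-unique s@(_ , inj₂ _) s′@(_ , inj₁ _) = sym (steps-unique s′ s)

steps-+ : ∀ {n i j l d₁ d₂} → i < n → d₁ + d₂ < n →
  Steps n i j d₁ → Steps n j l d₂ → Steps n i l (d₁ + d₂)
steps-+ {n} {i} {j} {l} {d₁} {d₂} i<n d<n (_ , s₁) (_ , s₂) = d<n , lands s₁ s₂
  where
    shift : ∀ {m} → i + d₁ ≡ m → i + (d₁ + d₂) ≡ m + d₂
    shift e = trans (sym (ℕ.+-assoc i d₁ d₂)) (cong (_+ d₂) e)
    wrapped : ∀ {m} → i + d₁ ≡ j + n → j + d₂ ≡ m → i + (d₁ + d₂) ≡ m + n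
    wrapped e₁ e₂ = trans (shift e₁) (trans (xy∙z≈xz∙y j n d₂) (cong (_+ n) e₂))
    lands : i + d₁ ≡ j ⊎ i + d₁ ≡ j + n → j + d₂ ≡ l ⊎ j + d₂ ≡ l + n →
            i + (d₁ + d₂) ≡ l ⊎ i + (d₁ + d₂) ≡ l + n
    lands (inj₁ e₁) (inj₁ e₂) = inj₁ (trans (shift e₁) e₂)
    lands (inj₁ e₁) (inj₂ e₂) = inj₂ (trans (shift e₁) e₂)
    lands (inj₂ e₁) (inj₁ e₂) = inj₂ (wrapped e₁ e₂)
    lands (inj₂ e₁) (inj₂ e₂) = contradiction (ℕ.+-mono-< i<n d<n) (ℕ.≤⇒≯ twice)
      where
        twice : n + n ≤ i + (d₁ + d₂)
        twice = ≡.subst (n + n ≤_) (sym (wrapped e₁ e₂)) (ℕ.+-monoˡ-≤ n (ℕ.m≤n+m n l))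

-- The distance d in the definition of Tadj: Tadj k i j reduces to (1 ≤ᵇ cdist k i j) ∧ (cdist k i j ≤ᵇ k).
cdist : (k : ℕ) → Fin (suc (2 * k)) → Fin (suc (2 * k)) → ℕ
cdist k i j = (toℕ j + suc (2 * k) ∸ toℕ i) % suc (2 * k)

cdist-steps : ∀ k i j → Steps (suc (2 * k)) (toℕ i) (toℕ j) (cdist k i j)
cdist-steps k i j = steps-% (suc (2 * k)) (Fin.toℕ<n i) (Fin.toℕ<n j)

cdist-self : ∀ k i → cdist k i i ≡ 0
cdist-self k i = steps-unique (cdist-steps k i i) (s≤s z≤n , inj₁ (ℕ.+-identityʳ (toℕ i)))

-- Two steps of length at most k never wrap around the (2k+1)-cycle.
cdist-+ : ∀ k {i j l} → cdist k i j ≤ k → cdist k j l ≤ k → cdist k i l ≡ cdist k i j + cdist k j l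
cdist-+ k {i} {j} {l} ij≤k jl≤k = steps-unique (cdist-steps k i l)
  (steps-+ (Fin.toℕ<n i) (s≤s (ℕ.+-mono-≤ ij≤k (ℕ.≤-trans jl≤k (ℕ.m≤m+n k 0))))
           (cdist-steps k i j) (cdist-steps k j l))

Tadj⇒ : ∀ {k i j} → Tadj k i j ≡ true → 0 < cdist k i j × cdist k i j ≤ k
Tadj⇒ {k} e with Equivalence.to Bool.T-∧ (Equivalence.from Bool.T-≡ e)
... | 1≤d , d≤k = ℕ.≤ᵇ⇒≤ 1 _ 1≤d , ℕ.≤ᵇ⇒≤ _ k d≤k

Tadj-true : ∀ {k i j} → 0 < cdist k i j → cdist k i j ≤ k → Tadj k i j ≡ true
Tadj-true {k} {i} {j} 0<d d≤k = cong₂ _∧_ (dec-true (1 ℕ.≤? cdist k i j) 0<d) (dec-true (cdist k i j ℕ.≤? k) d≤k)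

Tadj-false : ∀ {k i j} → k < cdist k i j → Tadj k i j ≡ false
Tadj-false {k} {i} {j} k<d =
  trans (cong ((1 ≤ᵇ cdist k i j) ∧_) (dec-false (cdist k i j ℕ.≤? k) (ℕ.<⇒≱ k<d))) (Bool.∧-zeroʳ _)

module _ (k : ℕ) (I : Fin (suc (2 * k)) → Digraph) (I-acyclic : ∀ i {x y z} → ¬ Cyclic (I i) x y z) where

  private
    T : Digraph
    T = TSubst k I

  offset : Carrier T → Carrier T → ℕ
  offset t p = cdist k (proj₁ t) (proj₁ p)

  offset-≤k : ∀ {t p} → T ⊢ t ⟶ p → offset t p ≤ k
  offset-≤k {i , _} {j , _} t⟶p with i ≟ j
  ... | yes refl = ℕ.≤-trans (ℕ.≤-reflexive (cdist-self k i)) z≤n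
  ... | no _ = proj₂ (Tadj⇒ {k} {i} {j} t⟶p)

  offset-< : ∀ {t p q} → T ⊢ t ⟶ p → Tadj k (proj₁ p) (proj₁ q) ≡ true → offset t p < offset t q
  offset-< {t} {p} {q} t⟶p pq with Tadj⇒ {k} {proj₁ p} {proj₁ q} pq
  ... | 0<d , d≤k =
    ≡.subst (offset t p <_) (sym (cdist-+ k {proj₁ t} {proj₁ p} {proj₁ q} (offset-≤k {t} {p} t⟶p) d≤k))
            (ℕ.m<m+n _ 0<d)

  offset-≤ : ∀ {t p q} → T ⊢ t ⟶ p → T ⊢ p ⟶ q → offset t p ≤ offset t q
  offset-≤ {t} {p} {q} t⟶p p⟶q with proj₁ p ≟ proj₁ q
  ... | yes same = ℕ.≤-reflexive (cong (cdist k (proj₁ t)) same)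
  ... | no _ = ℕ.<⇒≤ (offset-< {t} {p} {q} t⟶p p⟶q)

  same-block : ∀ {t p q} → T ⊢ t ⟶ p → T ⊢ p ⟶ q → offset t q ≤ offset t p → proj₁ p ≡ proj₁ q
  same-block {t} {p} {q} t⟶p p⟶q back with proj₁ p ≟ proj₁ q
  ... | yes same = same
  ... | no _ = contradiction back (ℕ.<⇒≱ (offset-< {t} {p} {q} t⟶p p⟶q))

  -- The offsets from t of a cyclic triangle it dominates cannot increase around the triangle,
  -- so the triangle lies in a single block.
  TSubst-D4Free : D4Free T
  TSubst-D4Free t {x@(i , _)} {y} {z} t⟶x t⟶y t⟶z (x⟶y , y⟶z , z⟶x)
    with same-block {t} {x} {y} t⟶x x⟶y
           (ℕ.≤-trans (offset-≤ {t} {y} {z} t⟶y y⟶z) (offset-≤ {t} {z} {x} t⟶z z⟶x))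
       | same-block {t} {y} {z} t⟶y y⟶z
           (ℕ.≤-trans (offset-≤ {t} {z} {x} t⟶z z⟶x) (offset-≤ {t} {x} {y} t⟶x x⟶y))
  ... | refl | refl = I-acyclic i (within x⟶y , within y⟶z , within z⟶x)
    where
      within : ∀ {x y} → T ⊢ (i , x) ⟶ (i , y) → I i ⊢ x ⟶ y
      within = trans (sym (subst-adj-within i _ _))

I2Subst-D4Free : ∀ {H J} → D4Free H → (∀ {x y z} → ¬ Cyclic J x y z) → D4Free (I2Subst H J)
I2Subst-D4Free H-d4 _ (zero , t) {zero , _} {zero , _} {zero , _} t⟶x t⟶y t⟶z cyc = H-d4 t t⟶x t⟶y t⟶z cyc
I2Subst-D4Free _ J-acyclic _ {suc zero , _} {suc zero , _} {suc zero , _} _ _ _ cyc = J-acyclic cyc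
I2Subst-D4Free _ _ (suc zero , _) {zero , _} () _ _ _
I2Subst-D4Free _ _ (suc zero , _) {suc zero , _} {zero , _} _ () _ _
I2Subst-D4Free _ _ (suc zero , _) {suc zero , _} {suc zero , _} {zero , _} _ _ () _
I2Subst-D4Free _ _ (zero , _) {zero , _} {zero , _} {suc zero , _} _ _ _ (_ , _ , ())
I2Subst-D4Free _ _ (zero , _) {zero , _} {suc zero , _} {zero , _} _ _ _ (_ , () , _)
I2Subst-D4Free _ _ (zero , _) {zero , _} {suc zero , _} {suc zero , _} _ _ _ (_ , _ , ())
I2Subst-D4Free _ _ (zero , _) {suc zero , _} {zero , _} {_ , _} _ _ _ (() , _ , _)
I2Subst-D4Free _ _ (zero , _) {suc zero , _} {suc zero , _} {zero , _} _ _ _ (_ , () , _)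

TnBlowUp : Digraph → Set₁
TnBlowUp G = Σ[ k ∈ ℕ ] Σ[ I ∈ (Fin (suc (2 * k)) → Digraph) ]
  ((∀ i → TransitiveTournament (I i)) ×
   ((G ≅ TSubst k I) ⊎ Σ[ J ∈ Digraph ] (TransitiveTournament J × (G ≅ I2Subst (TSubst k I) J))))

TnBlowUp⇒D4Free : ∀ {G} → TnBlowUp G → D4Free G
TnBlowUp⇒D4Free (k , I , I-tr , inj₁ G≅T) =
  D4Free-≅ G≅T (TSubst-D4Free k I (λ i → TransitiveTournament⇒acyclic (I-tr i)))
TnBlowUp⇒D4Free (k , I , I-tr , inj₂ (J , J-tr , G≅I₂)) =
  D4Free-≅ G≅I₂ (I2Subst-D4Free (TSubst-D4Free k I (λ i → TransitiveTournament⇒acyclic (I-tr i)))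
                                (TransitiveTournament⇒acyclic J-tr))

-- Triangle-free sets are transitively ordered

Induced : (G : Digraph) → (Carrier G → Set) → Digraph
Induced G P = record { Carrier = Σ (Carrier G) P ; adj = λ u v → adj G (proj₁ u) (proj₁ v) }

Σ-≡ : ∀ {A : Set} {P : A → Set} → (∀ {u} (p q : P u) → p ≡ q) →
  ∀ {u v} {p : P u} {q : P v} → u ≡ v → (u , p) ≡ (v , q)
Σ-≡ P-irrelevant {u} refl = cong (u ,_) (P-irrelevant _ _)

Induced-isTournament : ∀ {G P} → (∀ {u} (p q : P u) → p ≡ q) → IsTournament G → IsTournament (Induced G P)
Induced-isTournament P-irrelevant (irreflexive , antisymmetric) =
  (λ u → irreflexive (proj₁ u)) , λ u v u≢v → antisymmetric (proj₁ u) (proj₁ v) (u≢v ∘ Σ-≡ P-irrelevant)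

AllPairs-lookup : ∀ {A : Set} {R : A → A → Set} {xs} → AllPairs R xs →
  ∀ {i j} → i Data.Fin.< j → R (lookup xs i) (lookup xs j)
AllPairs-lookup (r ∷ _) {zero} {suc j} _ = All.lookup r (∈-lookup j)
AllPairs-lookup (_ ∷ rs) {suc i} {suc j} (s≤s i<j) = AllPairs-lookup rs i<j

module Ordering {N} {a : Fin N → Fin N → Bool} (isT : IsTournament (finDigraph N a))
  {P : Fin N → Set} (P? : Decidable P) (P-triangle-free : TriangleFree (finDigraph N a) P) where

  private
    G : Digraph
    G = finDigraph N a

    _⟶_ : Fin N → Fin N → Set
    x ⟶ y = G ⊢ x ⟶ y
  open Tournament isT

  insert : Fin N → List (Fin N) → List (Fin N)
  insert x [] = x ∷ []
  insert x (y ∷ ys) with x ≟ y | x ⟶? y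
  ... | yes _ | _ = y ∷ ys
  ... | no _ | yes _ = x ∷ y ∷ ys
  ... | no _ | no _ = y ∷ insert x ys

  ∈-insert⁻ : ∀ x ys {z} → z ∈ insert x ys → z ≡ x ⊎ z ∈ ys
  ∈-insert⁻ x [] (here z≡x) = inj₁ z≡x
  ∈-insert⁻ x (y ∷ ys) z∈ with x ≟ y | x ⟶? y
  ... | yes _ | _ = inj₂ z∈
  ... | no _ | yes _ = split z∈
    where
      split : ∀ {z} → z ∈ x ∷ y ∷ ys → z ≡ x ⊎ z ∈ y ∷ ys
      split (here z≡x) = inj₁ z≡x
      split (there z∈) = inj₂ z∈
  ∈-insert⁻ x (y ∷ ys) (here z≡y) | no _ | no _ = inj₂ (here z≡y)
  ∈-insert⁻ x (y ∷ ys) (there z∈) | no _ | no _ with ∈-insert⁻ x ys z∈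
  ... | inj₁ z≡x = inj₁ z≡x
  ... | inj₂ z∈ys = inj₂ (there z∈ys)

  ∈-insert-self : ∀ x ys → x ∈ insert x ys
  ∈-insert-self x [] = here refl
  ∈-insert-self x (y ∷ ys) with x ≟ y | x ⟶? y
  ... | yes x≡y | _ = here x≡y
  ... | no _ | yes _ = here refl
  ... | no _ | no _ = there (∈-insert-self x ys)

  ∈-insert⁺ : ∀ x ys {z} → z ∈ ys → z ∈ insert x ys
  ∈-insert⁺ x (y ∷ ys) z∈ with x ≟ y | x ⟶? y
  ... | yes _ | _ = z∈
  ... | no _ | yes _ = there z∈
  ∈-insert⁺ x (y ∷ ys) (here z≡y) | no _ | no _ = here z≡y
  ∈-insert⁺ x (y ∷ ys) (there z∈) | no _ | no _ = there (∈-insert⁺ x ys z∈)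

  insert-chain : ∀ {x ys} → P x → All P ys → AllPairs _⟶_ ys → AllPairs _⟶_ (insert x ys)
  insert-chain {x} {[]} _ _ _ = All.[] ∷ []
  insert-chain {x} {y ∷ ys} Px Pys chain with x ≟ y | x ⟶? y
  ... | yes _ | _ = chain
  ... | no _ | yes x⟶y = All.tabulate x⟶ ∷ chain
    where
      y-first : All (y ⟶_) ys
      y-first = AllPairs.head chain
      x⟶ : ∀ {z} → z ∈ y ∷ ys → x ⟶ z
      x⟶ (here refl) = x⟶y
      x⟶ (there z∈) = ¬⟶⇒⟵ z≢x λ z⟶x →
        P-triangle-free Px (All.lookup Pys (here refl)) (All.lookup Pys (there z∈)) (x⟶y , All.lookup y-first z∈ , z⟶x)
        where
          z≢x : _ ≢ x
          z≢x refl = ⟶-asym x⟶y (All.lookup y-first z∈)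
  ... | no x≢y | no ¬x⟶y = All.tabulate y⟶ ∷ insert-chain Px (All.tail Pys) (AllPairs.tail chain)
    where
      y⟶ : ∀ {z} → z ∈ insert x ys → y ⟶ z
      y⟶ z∈ with ∈-insert⁻ x ys z∈
      ... | inj₁ refl = ¬⟶⇒⟵ x≢y ¬x⟶y
      ... | inj₂ z∈ys = All.lookup (AllPairs.head chain) z∈ys

  sort : List (Fin N) → List (Fin N)
  sort = foldr insert []

  ∈-sort⁻ : ∀ xs {z} → z ∈ sort xs → z ∈ xs
  ∈-sort⁻ (x ∷ xs) z∈ with ∈-insert⁻ x (sort xs) z∈
  ... | inj₁ z≡x = here z≡x
  ... | inj₂ z∈sort = there (∈-sort⁻ xs z∈sort)

  ∈-sort⁺ : ∀ xs {z} → z ∈ xs → z ∈ sort xs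
  ∈-sort⁺ (x ∷ xs) (here refl) = ∈-insert-self x (sort xs)
  ∈-sort⁺ (x ∷ xs) (there z∈) = ∈-insert⁺ x (sort xs) (∈-sort⁺ xs z∈)

  sort-chain : ∀ {xs} → All P xs → AllPairs _⟶_ (sort xs)
  sort-chain {[]} _ = []
  sort-chain {x ∷ xs} Pxs =
    insert-chain (All.head Pxs) (All.tabulate (All.lookup (All.tail Pxs) ∘ ∈-sort⁻ xs)) (sort-chain (All.tail Pxs))

  members : List (Fin N)
  members = sort (filter P? (allFin N))

  ∈-members⁺ : ∀ {z} → P z → z ∈ members
  ∈-members⁺ {z} Pz = ∈-sort⁺ (filter P? (allFin N)) (∈-filter⁺ P? (∈-allFin z) Pz)

  ∈-members⁻ : ∀ {z} → z ∈ members → P z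
  ∈-members⁻ z∈ = proj₂ (∈-filter⁻ P? {xs = allFin N} (∈-sort⁻ (filter P? (allFin N)) z∈))

  members-chain : AllPairs _⟶_ members
  members-chain = sort-chain (All.tabulate (proj₂ ∘ ∈-filter⁻ P? {xs = allFin N}))

  source : ∀ {u} → P u → Σ[ c ∈ Fin N ] (P c × (∀ {v} → P v → v ≡ c ⊎ c ⟶ v))
  source {u} Pu = first members (∈-members⁺ Pu) members-chain ∈-members⁻ ∈-members⁺
    where
      first : ∀ xs → u ∈ xs → AllPairs _⟶_ xs → (∀ {z} → z ∈ xs → P z) → (∀ {z} → P z → z ∈ xs) →
              Σ[ c ∈ Fin N ] (P c × (∀ {v} → P v → v ≡ c ⊎ c ⟶ v))
      first (c ∷ xs) _ (c-first ∷ _) ∈⇒P P⇒∈ = c , ∈⇒P (here refl) , λ Pv → after (P⇒∈ Pv)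
        where
          after : ∀ {v} → v ∈ c ∷ xs → v ≡ c ⊎ c ⟶ v
          after (here v≡c) = inj₁ v≡c
          after (there v∈) = inj₂ (All.lookup c-first v∈)

  members-lookup-injective : ∀ {i j} → lookup members i ≡ lookup members j → i ≡ j
  members-lookup-injective {i} {j} eq with Fin.<-cmp i j
  ... | tri< i<j _ _ = contradiction eq (⟶⇒≢ (AllPairs-lookup members-chain i<j))
  ... | tri≈ _ i≡j _ = i≡j
  ... | tri> _ _ j<i = contradiction (sym eq) (⟶⇒≢ (AllPairs-lookup members-chain j<i))

  module _ (P-irrelevant : ∀ {u} (p q : P u) → p ≡ q) where

    members-↔ : Fin (length members) ↔ Σ (Fin N) P
    members-↔ = mk↔ₛ′ to from to∘from from∘to
      where
        to : Fin (length members) → Σ (Fin N) P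
        to i = lookup members i , ∈-members⁻ (∈-lookup i)
        from : Σ (Fin N) P → Fin (length members)
        from (_ , Pu) = index (∈-members⁺ Pu)
        to∘from : ∀ u → to (from u) ≡ u
        to∘from (_ , Pu) = Σ-≡ P-irrelevant (sym (lookup-index (∈-members⁺ Pu)))
        from∘to : ∀ i → from (to i) ≡ i
        from∘to i = members-lookup-injective (sym (lookup-index (∈-members⁺ (∈-members⁻ (∈-lookup i)))))

    Induced-transitiveTournament : ∀ {u} → P u → TransitiveTournament (Induced G P)
    Induced-transitiveTournament {u} Pu =
      Induced-isTournament P-irrelevant isT ,
      (length members , members-↔ , λ i j i<j → AllPairs-lookup members-chain i<j) ,
      (u , Pu)

module _ {N} {a : Fin N → Fin N → Bool} where

  reverse-isTournament : IsTournament (finDigraph N a) → IsTournament (finDigraph N (flip a))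
  reverse-isTournament (irreflexive , antisymmetric) = irreflexive , λ x y x≢y → antisymmetric y x (x≢y ∘ sym)

  reverse-triangleFree : ∀ {P} → TriangleFree (finDigraph N a) P → TriangleFree (finDigraph N (flip a)) P
  reverse-triangleFree tf Px Py Pz (y⟶x , z⟶y , x⟶z) = tf Px Pz Py (x⟶z , z⟶y , y⟶x)

  sink : IsTournament (finDigraph N a) → ∀ {P} (P? : Decidable P) → TriangleFree (finDigraph N a) P →
    ∀ {u} → P u → Σ[ c ∈ Fin N ] (P c × (∀ {v} → P v → v ≡ c ⊎ finDigraph N a ⊢ v ⟶ c))
  sink isT P? tf = Ordering.source (reverse-isTournament isT) P? (reverse-triangleFree tf)

-- Block decompositions

≅-trans : ∀ {G H K} → G ≅ H → H ≅ K → G ≅ K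
≅-trans G≅H H≅K = record
  { bij = ↔-trans (_≅_.bij G≅H) (_≅_.bij H≅K)
  ; pres = λ x y → trans (_≅_.pres H≅K _ _) (_≅_.pres G≅H x y)
  }

I2Subst-empty : ∀ {H J} → ¬ Carrier J → I2Subst H J ≅ H
I2Subst-empty {H} {J} ¬J = record { bij = mk↔ₛ′ to (zero ,_) (λ _ → refl) from∘to ; pres = pres }
  where
    to : Carrier (I2Subst H J) → Carrier H
    to (zero , x) = x
    to (suc zero , y) = contradiction y ¬J
    from∘to : ∀ x → (zero , to x) ≡ x
    from∘to (zero , x) = refl
    from∘to (suc zero , y) = contradiction y ¬J
    pres : ∀ x y → adj H (to x) (to y) ≡ adj (I2Subst H J) x y
    pres (zero , x) (zero , y) = refl
    pres (zero , _) (suc zero , y) = contradiction y ¬J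
    pres (suc zero , x) _ = contradiction x ¬J

-- `block u ≡ nothing` places u in the bottom block I of I₂(T_n(I¹,…,Iⁿ), I).
record BlockDecomposition {N} (a : Fin N → Fin N → Bool) : Set where
  field
    k : ℕ
    block : Fin N → Maybe (Fin (suc (2 * k)))
    across : ∀ {u v i j} → block u ≡ just i → block v ≡ just j → i ≢ j → a u v ≡ Tadj k i j
    above-bottom : ∀ {u v i} → block u ≡ just i → block v ≡ nothing → finDigraph N a ⊢ u ⟶ v
    inhabited : ∀ i → ∃ λ u → block u ≡ just i
    triangle-free : ∀ b → TriangleFree (finDigraph N a) (λ u → block u ≡ b)

module _ {N} {a : Fin N → Fin N → Bool} (isT : IsTournament (finDigraph N a)) (D : BlockDecomposition a) where

  open BlockDecomposition D
  open Tournament isT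

  private
    G : Digraph
    G = finDigraph N a

    n : ℕ
    n = suc (2 * k)

    Block : Maybe (Fin n) → Fin N → Set
    Block b u = block u ≡ b

    block? : ∀ b → Decidable (Block b)
    block? b u = Maybe.≡-dec _≟_ (block u) b

    block-irrelevant : ∀ {b u} (p q : Block b u) → p ≡ q
    block-irrelevant = Decidable⇒UIP.≡-irrelevant (Maybe.≡-dec _≟_)

    I : Fin n → Digraph
    I i = Induced G (Block (just i))

    J : Digraph
    J = Induced G (Block nothing)

    I₂ : Digraph
    I₂ = I2Subst (TSubst k I) J

    transitive : ∀ b {u} → Block b u → TransitiveTournament (Induced G (Block b))
    transitive b = Ordering.Induced-transitiveTournament isT (block? b) (triangle-free b) block-irrelevant

    I-transitive : ∀ i → TransitiveTournament (I i)
    I-transitive i = transitive (just i) (proj₂ (inhabited i))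

    vertex : ∀ u b → block u ≡ b → Carrier I₂
    vertex u (just i) e = zero , i , u , e
    vertex u nothing e = suc zero , u , e

    to : Fin N → Carrier I₂
    to u = vertex u (block u) refl

    from : Carrier I₂ → Fin N
    from (zero , _ , u , _) = u
    from (suc zero , u , _) = u

    to-vertex : ∀ u {b} (e : block u ≡ b) → to u ≡ vertex u b e
    to-vertex u refl = refl

    from-vertex : ∀ u b (e : block u ≡ b) → from (vertex u b e) ≡ u
    from-vertex u (just _) _ = refl
    from-vertex u nothing _ = refl

    to∘from : ∀ x → to (from x) ≡ x
    to∘from (zero , _ , u , e) = to-vertex u e
    to∘from (suc zero , u , e) = to-vertex u e

    vertex-adj : ∀ {u v} b b′ (e : block u ≡ b) (e′ : block v ≡ b′) →
                 adj I₂ (vertex u b e) (vertex v b′ e′) ≡ a u v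
    vertex-adj (just i) (just j) e e′ with i ≟ j
    ... | yes refl = refl
    ... | no i≢j = sym (across e e′ i≢j)
    vertex-adj (just _) nothing e e′ = sym (above-bottom e e′)
    vertex-adj nothing (just _) e e′ = sym (Bool.¬-not (⟶-asym (above-bottom e′ e)))
    vertex-adj nothing nothing _ _ = refl

  BlockDecomposition-≅ : G ≅ I₂
  BlockDecomposition-≅ = record
    { bij = mk↔ₛ′ to from to∘from (λ u → from-vertex u (block u) refl)
    ; pres = λ u v → vertex-adj (block u) (block v) refl refl
    }

  BlockDecomposition⇒TnBlowUp : TnBlowUp G
  BlockDecomposition⇒TnBlowUp with Fin.any? (block? nothing)
  ... | yes (_ , bottom) = k , I , I-transitive , inj₂ (J , transitive nothing bottom , BlockDecomposition-≅)
  ... | no no-bottom = k , I , I-transitive , inj₁ (≅-trans BlockDecomposition-≅ (I2Subst-empty no-bottom))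

-- Deleting a sink or a clone

module _ {M N} {a : Fin N → Fin N → Bool} (f : Fin M → Fin N) where

  on-isTournament : (∀ {x y} → f x ≡ f y → x ≡ y) →
                    IsTournament (finDigraph N a) → IsTournament (finDigraph M (a on f))
  on-isTournament f-injective (irreflexive , antisymmetric) =
    (λ x → irreflexive (f x)) , λ x y x≢y → antisymmetric (f x) (f y) (x≢y ∘ f-injective)

  on-D4Free : D4Free (finDigraph N a) → D4Free (finDigraph M (a on f))
  on-D4Free d4 t = d4 (f t)

data Punched {M} (w : Fin (suc M)) : Fin (suc M) → Set where
  removed : Punched w w
  kept : ∀ x → Punched w (punchIn w x)

punched : ∀ {M} (w u : Fin (suc M)) → Punched w u
punched w u with w ≟ u
... | yes refl = removed
... | no w≢u = ≡.subst (Punched w) (Fin.punchIn-punchOut w≢u) (kept (punchOut w≢u))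

Clone : ∀ {N} → (Fin N → Fin N → Bool) → Fin N → Fin N → Set
Clone a v w = a v w ≡ true × (∀ u → u ≢ v → u ≢ w → a v u ≡ a w u)

-- A block decomposition of a tournament with w deleted extends to the whole tournament
-- when w is a sink or a clone.
module Extension {M} {a : Fin (suc M) → Fin (suc M) → Bool} (isT : IsTournament (finDigraph (suc M) a))
  (w : Fin (suc M)) where

  private
    G : Digraph
    G = finDigraph (suc M) a
  open Tournament isT

  a₋ : Fin M → Fin M → Bool
  a₋ = a on punchIn w

  isT₋ : IsTournament (finDigraph M a₋)
  isT₋ = on-isTournament (punchIn w) (Fin.punchIn-injective w _ _) isT

  remove : Fin (suc M) → Maybe (Fin M)
  remove u with w ≟ u
  ... | yes _ = nothing
  ... | no w≢u = just (punchOut w≢u)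

  remove-removed : remove w ≡ nothing
  remove-removed with w ≟ w
  ... | yes _ = refl
  ... | no w≢w = contradiction refl w≢w

  remove-kept : ∀ x → remove (punchIn w x) ≡ just x
  remove-kept x with w ≟ punchIn w x
  ... | yes w≡ = contradiction (sym w≡) (Fin.punchInᵢ≢i w x)
  ... | no _ = cong just (trans (Fin.punchOut-cong w refl) (Fin.punchOut-punchIn w))

  add-sink : (∀ u → ¬ G ⊢ w ⟶ u) → BlockDecomposition a₋ → BlockDecomposition a
  add-sink sink D = record
    { k = k ; block = block⁺ ; across = across⁺ ; above-bottom = above⁺
    ; inhabited = inhabited⁺ ; triangle-free = triangle-free⁺ }
    where
      open BlockDecomposition D

      block⁺ : Fin (suc M) → Maybe (Fin (suc (2 * k)))
      block⁺ = maybe block nothing ∘ remove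

      block⁺-kept : ∀ {x b} → block⁺ (punchIn w x) ≡ b → block x ≡ b
      block⁺-kept {x} = trans (sym (cong (maybe block nothing) (remove-kept x)))

      block⁺-removed : ∀ {b} → block⁺ w ≡ b → nothing ≡ b
      block⁺-removed = trans (sym (cong (maybe block nothing) remove-removed))

      across⁺ : ∀ {u v i j} → block⁺ u ≡ just i → block⁺ v ≡ just j → i ≢ j → a u v ≡ Tadj k i j
      across⁺ {u} {v} bu bv i≢j with punched w u | punched w v
      ... | removed | _ = case block⁺-removed bu of λ ()
      ... | kept _ | removed = case block⁺-removed bv of λ ()
      ... | kept _ | kept _ = across (block⁺-kept bu) (block⁺-kept bv) i≢j

      above⁺ : ∀ {u v i} → block⁺ u ≡ just i → block⁺ v ≡ nothing → G ⊢ u ⟶ v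
      above⁺ {u} {v} bu bv with punched w u | punched w v
      ... | removed | _ = case block⁺-removed bu of λ ()
      ... | kept x | removed = ¬⟶⇒⟵ (Fin.punchInᵢ≢i w x ∘ sym) (sink (punchIn w x))
      ... | kept _ | kept _ = above-bottom (block⁺-kept bu) (block⁺-kept bv)

      inhabited⁺ : ∀ i → ∃ λ u → block⁺ u ≡ just i
      inhabited⁺ i with inhabited i
      ... | x , bx = punchIn w x , trans (cong (maybe block nothing) (remove-kept x)) bx

      triangle-free⁺ : ∀ b → TriangleFree G (λ u → block⁺ u ≡ b)
      triangle-free⁺ b {x} {y} {z} bx by bz cyc@(x⟶y , y⟶z , z⟶x) with punched w x | punched w y | punched w z
      ... | removed | _ | _ = sink _ x⟶y
      ... | kept _ | removed | _ = sink _ y⟶z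
      ... | kept _ | kept _ | removed = sink _ z⟶x
      ... | kept _ | kept _ | kept _ = triangle-free b (block⁺-kept bx) (block⁺-kept by) (block⁺-kept bz) cyc

  add-clone : ∀ {v} → Clone a v w → BlockDecomposition a₋ → BlockDecomposition a
  add-clone {v} (v⟶w , v≈w) D = record
    { k = k ; block = block ∘ collapse ; across = across⁺ ; above-bottom = above⁺
    ; inhabited = inhabited⁺ ; triangle-free = triangle-free⁺ }
    where
      open BlockDecomposition D

      w≢v : w ≢ v
      w≢v = ⟶⇒≢ v⟶w ∘ sym

      v₋ : Fin M
      v₋ = punchOut w≢v

      v-kept : punchIn w v₋ ≡ v
      v-kept = Fin.punchIn-punchOut w≢v

      collapse : Fin (suc M) → Fin M
      collapse = fromMaybe v₋ ∘ remove

      collapse-removed : collapse w ≡ v₋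
      collapse-removed = cong (fromMaybe v₋) remove-removed

      collapse-kept : ∀ x → collapse (punchIn w x) ≡ x
      collapse-kept x = cong (fromMaybe v₋) (remove-kept x)

      merged : ∀ {y} → punchIn w y ≡ v → collapse w ≡ collapse (punchIn w y)
      merged {y} e = trans collapse-removed (trans (sym y≡v₋) (sym (collapse-kept y)))
        where
          y≡v₋ : y ≡ v₋
          y≡v₋ = Fin.punchIn-injective w y v₋ (trans e (sym v-kept))

      w-out : ∀ {u} → u ≢ v → u ≢ w → a w u ≡ a (punchIn w v₋) u
      w-out u≢v u≢w = trans (sym (v≈w _ u≢v u≢w)) (cong (λ x → a x _) (sym v-kept))

      w-in : ∀ {u} → u ≢ v → u ≢ w → a u w ≡ a u (punchIn w v₋)
      w-in {u} u≢v u≢w = begin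
        a u w                     ≡⟨ proj₂ isT w u (u≢w ∘ sym) ⟩
        not (a w u)               ≡⟨ cong not (w-out u≢v u≢w) ⟩
        not (a (punchIn w v₋) u)  ≡⟨ sym (proj₂ isT (punchIn w v₋) u (λ e → u≢v (trans (sym e) v-kept))) ⟩
        a u (punchIn w v₋)        ∎
        where open ≡-Reasoning

      collapse-adj : ∀ {u t} → collapse u ≢ collapse t → a u t ≡ a₋ (collapse u) (collapse t)
      collapse-adj {u} {t} ne with punched w u | punched w t
      ... | removed | removed = contradiction refl ne
      ... | kept x | kept y = sym (cong₂ a₋ (collapse-kept x) (collapse-kept y))
      ... | removed | kept y =
        trans (w-out (ne ∘ merged) (Fin.punchInᵢ≢i w y)) (sym (cong₂ a₋ collapse-removed (collapse-kept y)))
      ... | kept x | removed =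
        trans (w-in (ne ∘ sym ∘ merged) (Fin.punchInᵢ≢i w x)) (sym (cong₂ a₋ (collapse-kept x) collapse-removed))

      -- A cyclic triangle cannot contain both v and w, as they relate in the same way to its third vertex.
      cyclic⇒collapse-≢ : ∀ {p q r} → Cyclic G p q r → collapse p ≢ collapse q
      cyclic⇒collapse-≢ {p} {q} {r} (p⟶q , q⟶r , r⟶p) e with punched w p | punched w q
      ... | removed | removed = ⟶-irrefl p⟶q
      ... | kept x | kept y = ⟶⇒≢ p⟶q (cong (punchIn w) (trans (sym (collapse-kept x)) (trans e (collapse-kept y))))
      ... | removed | kept y = ⟶-asym v⟶w (≡.subst (G ⊢ w ⟶_) (trans (cong (punchIn w) y≡v₋) v-kept) p⟶q)
        where
          y≡v₋ : y ≡ v₋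
          y≡v₋ = trans (sym (collapse-kept y)) (trans (sym e) collapse-removed)
      ... | kept x | removed = ⟶-asym r⟶v (trans (v≈w r (⟶⇒≢ r⟶v) (⟶⇒≢ q⟶r ∘ sym)) q⟶r)
        where
          x≡v₋ : x ≡ v₋
          x≡v₋ = trans (sym (collapse-kept x)) (trans e collapse-removed)
          r⟶v : G ⊢ r ⟶ v
          r⟶v = ≡.subst (G ⊢ r ⟶_) (trans (cong (punchIn w) x≡v₋) v-kept) r⟶p

      down : ∀ {p q} → collapse p ≢ collapse q → G ⊢ p ⟶ q → finDigraph M a₋ ⊢ collapse p ⟶ collapse q
      down ne = trans (sym (collapse-adj ne))

      across⁺ : ∀ {u t i j} → block (collapse u) ≡ just i → block (collapse t) ≡ just j → i ≢ j →
                a u t ≡ Tadj k i j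
      across⁺ bu bt i≢j =
        trans (collapse-adj (i≢j ∘ Maybe.just-injective ∘ λ e → trans (sym bu) (trans (cong block e) bt))) (across bu bt i≢j)

      above⁺ : ∀ {u t i} → block (collapse u) ≡ just i → block (collapse t) ≡ nothing → G ⊢ u ⟶ t
      above⁺ bu bt =
        trans (collapse-adj (λ e → case trans (sym bu) (trans (cong block e) bt) of λ ())) (above-bottom bu bt)

      inhabited⁺ : ∀ i → ∃ λ u → block (collapse u) ≡ just i
      inhabited⁺ i with inhabited i
      ... | x , bx = punchIn w x , trans (cong block (collapse-kept x)) bx

      triangle-free⁺ : ∀ b → TriangleFree G (λ u → block (collapse u) ≡ b)
      triangle-free⁺ b bx by bz cyc@(x⟶y , y⟶z , z⟶x) = triangle-free b bx by bz
        ( down (cyclic⇒collapse-≢ cyc) x⟶y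
        , down (cyclic⇒collapse-≢ (rotate {G} cyc)) y⟶z
        , down (cyclic⇒collapse-≢ (rotate {G} (rotate {G} cyc))) z⟶x )

-- Tournaments without sinks and clones are circulant

module Circulant {N} {a : Fin N → Fin N → Bool} (isT : IsTournament (finDigraph N a))
  (d4 : D4Free (finDigraph N a)) (has-out : ∀ x → ∃ λ u → finDigraph N a ⊢ x ⟶ u) where

  private
    G : Digraph
    G = finDigraph N a

    infix 4 _⟶_
    _⟶_ : Fin N → Fin N → Set
    x ⟶ y = G ⊢ x ⟶ y

  open Tournament isT

  ⟶⟶cyclic⇒⟵ : ∀ {t c w q} → t ⟶ c → t ⟶ w → Cyclic G c w q → q ⟶ t
  ⟶⟶cyclic⇒⟵ t⟶c t⟶w cyc@(_ , w⟶q , _) = ¬⟶⇒⟵ t≢q (λ t⟶q → d4 _ t⟶c t⟶w t⟶q cyc)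
    where
      t≢q : _ ≢ _
      t≢q refl = ⟶-asym t⟶w w⟶q

  common-out-closed : ∀ {x y z w q} → Cyclic G x y z → x ⟶ w → y ⟶ w → z ⟶ w → w ⟶ q → x ⟶ q
  common-out-closed (x⟶y , y⟶z , z⟶x) x⟶w y⟶w z⟶w w⟶q = ¬⟶⇒⟵ q≢x λ q⟶x →
    let q⟶z = ⟶⟶cyclic⇒⟵ z⟶x z⟶w (x⟶w , w⟶q , q⟶x)
        q⟶y = ⟶⟶cyclic⇒⟵ y⟶z y⟶w (z⟶w , w⟶q , q⟶z)
    in d4 _ q⟶x q⟶y q⟶z (x⟶y , y⟶z , z⟶x)
    where
      q≢x : _ ≢ _
      q≢x refl = ⟶-asym x⟶w w⟶q

  -- The common out-neighbours of a cyclic triangle have no sink, as the out-neighbours of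
  -- a sink would again be common out-neighbours.
  common-out-free : ∀ {x y z u} → Cyclic G x y z → x ⟶ u → y ⟶ u → z ⟶ u → ⊥
  common-out-free {x} {y} {z} cyc x⟶u y⟶u z⟶u = no-sink (sink isT W? W-triangle-free (x⟶u , y⟶u , z⟶u))
    where
      W : Fin N → Set
      W v = x ⟶ v × y ⟶ v × z ⟶ v
      W? : Decidable W
      W? v = (x ⟶? v) ×-dec (y ⟶? v) ×-dec (z ⟶? v)
      W-triangle-free : TriangleFree G W
      W-triangle-free Wp Wq Wr = d4 x (proj₁ Wp) (proj₁ Wq) (proj₁ Wr)
      no-sink : ¬ (Σ[ c ∈ Fin N ] (W c × (∀ {v} → W v → v ≡ c ⊎ v ⟶ c)))
      no-sink (c , (x⟶c , y⟶c , z⟶c) , c-last) with has-out c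
      ... | q , c⟶q with c-last ( common-out-closed cyc x⟶c y⟶c z⟶c c⟶q
                                , common-out-closed (rotate {G} cyc) y⟶c z⟶c x⟶c c⟶q
                                , common-out-closed (rotate {G} (rotate {G} cyc)) z⟶c x⟶c y⟶c c⟶q )
      ...   | inj₁ refl = ⟶-irrefl c⟶q
      ...   | inj₂ q⟶c = ⟶-asym c⟶q q⟶c

  first-out : ∀ x → Σ[ c ∈ Fin N ] (x ⟶ c × (∀ {v} → x ⟶ v → v ≡ c ⊎ c ⟶ v))
  first-out x = Ordering.source isT (x ⟶?_) (d4 x) (proj₂ (has-out x))

  abstract
    next : Fin N → Fin N
    next x = proj₁ (first-out x)

    ⟶next : ∀ x → x ⟶ next x
    ⟶next x = proj₁ (proj₂ (first-out x))

    next-first : ∀ {x v} → x ⟶ v → v ≡ next x ⊎ next x ⟶ v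
    next-first {x} = proj₂ (proj₂ (first-out x))

  ⟶⇒next-≢ : ∀ {x y} → x ⟶ y → next x ≢ next y
  ⟶⇒next-≢ {x} {y} x⟶y eq with next-first x⟶y
  ... | inj₁ y≡next-x = ⟶-irrefl (≡.subst (y ⟶_) (trans (sym eq) (sym y≡next-x)) (⟶next y))
  ... | inj₂ next-x⟶y = ⟶-asym (⟶next y) (≡.subst (_⟶ y) eq next-x⟶y)

  next-injective : ∀ {x y} → next x ≡ next y → x ≡ y
  next-injective {x} {y} eq with x ≟ y | x ⟶? y
  ... | yes x≡y | _ = x≡y
  ... | no _ | yes x⟶y = contradiction eq (⟶⇒next-≢ x⟶y)
  ... | no x≢y | no ¬x⟶y = contradiction (sym eq) (⟶⇒next-≢ (¬⟶⇒⟵ x≢y ¬x⟶y))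

  next^ : ℕ → Fin N → Fin N
  next^ zero x = x
  next^ (suc m) x = next (next^ m x)

  next^-+ : ∀ m n x → next^ (m + n) x ≡ next^ m (next^ n x)
  next^-+ zero n x = refl
  next^-+ (suc m) n x = cong next (next^-+ m n x)

  next^-next : ∀ m x → next^ m (next x) ≡ next^ (suc m) x
  next^-next m x = sym (trans (cong (λ l → next^ l x) (ℕ.+-comm 1 m)) (next^-+ m 1 x))

  module OutNeighbours (x : Fin N) where

    s : ℕ → Fin N
    s l = next^ (suc l) x

    -- The invariant of the construction: s 0, …, s (j-1) are the j highest out-neighbours of x.
    record Chain (j : ℕ) : Set where
      field
        out : ∀ {l} → l < j → x ⟶ s l
        ascending : ∀ {i l} → i < l → l < j → s i ⟶ s l
        above-rest : ∀ {i u} → i < j → x ⟶ u → (∀ {l} → l ≤ i → s l ≢ u) → s i ⟶ u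

    chain-1 : Chain 1
    chain-1 = record
      { out = λ { (s≤s z≤n) → ⟶next x }
      ; ascending = λ i<l l<1 → contradiction (ℕ.<-≤-trans i<l (ℕ.≤-pred l<1)) ℕ.n≮0
      ; above-rest = above-rest
      }
      where
        above-rest : ∀ {i u} → i < 1 → x ⟶ u → (∀ {l} → l ≤ i → s l ≢ u) → s i ⟶ u
        above-rest (s≤s z≤n) x⟶u new with next-first x⟶u
        ... | inj₁ u≡s0 = contradiction (sym u≡s0) (new z≤n)
        ... | inj₂ s0⟶u = s0⟶u

    chain-extend : ∀ {j u} → Chain (suc j) → x ⟶ u → (∀ {l} → l < suc j → s l ≢ u) → Chain (suc (suc j))
    chain-extend {j} {u} c x⟶u new = record { out = out′ ; ascending = ascending′ ; above-rest = above-rest′ }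
      where
        open Chain c
        x⟶sj : x ⟶ s j
        x⟶sj = out ℕ.≤-refl

        sj⟶u : s j ⟶ u
        sj⟶u = above-rest ℕ.≤-refl x⟶u (new ∘ s≤s)

        sj⟶t : s j ⟶ s (suc j)
        sj⟶t = ⟶next (s j)

        -- Otherwise x, s j, s (1+j) would be a cyclic triangle with common out-neighbour u.
        x⟶t : x ⟶ s (suc j)
        x⟶t = ¬⟶⇒⟵ t≢x λ t⟶x → case next-first sj⟶u of λ
          { (inj₁ refl) → ⟶-asym x⟶u t⟶x
          ; (inj₂ t⟶u) → common-out-free (x⟶sj , sj⟶t , t⟶x) x⟶u sj⟶u t⟶u }
          where
            t≢x : s (suc j) ≢ x
            t≢x t≡x = ⟶-asym x⟶sj (≡.subst (s j ⟶_) t≡x sj⟶t)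

        t-new : ∀ {l} → l < suc j → s l ≢ s (suc j)
        t-new {l} l<1+j with ℕ.m<1+n⇒m<n∨m≡n l<1+j
        ... | inj₁ l<j = λ sl≡t → ⟶-asym (ascending l<j ℕ.≤-refl) (≡.subst (s j ⟶_) (sym sl≡t) sj⟶t)
        ... | inj₂ refl = ⟶⇒≢ sj⟶t

        out′ : ∀ {l} → l < suc (suc j) → x ⟶ s l
        out′ l< with ℕ.m<1+n⇒m<n∨m≡n l<
        ... | inj₁ l<1+j = out l<1+j
        ... | inj₂ refl = x⟶t

        ascending′ : ∀ {i l} → i < l → l < suc (suc j) → s i ⟶ s l
        ascending′ i<l l< with ℕ.m<1+n⇒m<n∨m≡n l<
        ... | inj₁ l<1+j = ascending i<l l<1+j
        ... | inj₂ refl = above-rest i<l x⟶t (λ l≤i → t-new (ℕ.≤-<-trans l≤i i<l))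

        above-rest′ : ∀ {i u} → i < suc (suc j) → x ⟶ u → (∀ {l} → l ≤ i → s l ≢ u) → s i ⟶ u
        above-rest′ i< x⟶u′ new′ with ℕ.m<1+n⇒m<n∨m≡n i<
        ... | inj₁ i<1+j = above-rest i<1+j x⟶u′ new′
        ... | inj₂ refl with next-first (above-rest ℕ.≤-refl x⟶u′ (new′ ∘ ℕ.m≤n⇒m≤1+n))
        ...   | inj₁ u′≡t = contradiction (sym u′≡t) (new′ ℕ.≤-refl)
        ...   | inj₂ t⟶u′ = t⟶u′

    chain-bound : ∀ {j} → Chain j → j ≤ N
    chain-bound {j} c = Fin.injective⇒≤ {f = s ∘ toℕ} injective
      where
        open Chain c
        injective : ∀ {i l} → s (toℕ i) ≡ s (toℕ l) → i ≡ l
        injective {i} {l} eq with Fin.<-cmp i l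
        ... | tri< i<l _ _ = contradiction eq (⟶⇒≢ (ascending i<l (Fin.toℕ<n l)))
        ... | tri≈ _ i≡l _ = i≡l
        ... | tri> _ _ l<i = contradiction (sym eq) (⟶⇒≢ (ascending l<i (Fin.toℕ<n i)))

    Covers : ℕ → Set
    Covers j = ∀ {u} → x ⟶ u → Σ[ l ∈ ℕ ] (l < j × s l ≡ u)

    listed? : ∀ j u → Dec (Σ[ l ∈ ℕ ] (l < j × s l ≡ u))
    listed? j u = map′ (λ (l , e) → toℕ l , Fin.toℕ<n l , e)
                       (λ (l , l<j , e) → fromℕ< l<j , trans (cong s (Fin.toℕ-fromℕ< l<j)) e)
                       (Fin.any? λ l → s (toℕ l) ≟ u)

    covers? : ∀ j → Covers j ⊎ Σ[ u ∈ Fin N ] (x ⟶ u × (∀ {l} → l < j → s l ≢ u))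
    covers? j with Fin.all? (λ u → ¬? (x ⟶? u) ⊎-dec listed? j u)
    ... | yes all = inj₁ λ {u} x⟶u → [ contradiction x⟶u , id ]′ (all u)
    ... | no ¬all with Fin.¬∀⟶∃¬ N _ (λ u → ¬? (x ⟶? u) ⊎-dec listed? j u) ¬all
    ...   | u , ¬u =
      inj₂ (u , decidable-stable (x ⟶? u) (¬u ∘ inj₁) , λ l<j sl≡u → ¬u (inj₂ (_ , l<j , sl≡u)))

    record Enumeration (d : ℕ) : Set where
      field
        out : ∀ {l} → l < d → x ⟶ s l
        covers : Covers d

    -- By chain-bound, N steps of fuel suffice to grow the chain until it covers.
    enumeration : Σ[ d ∈ ℕ ] Enumeration d
    enumeration = grow chain-1 N ℕ.≤-refl
      where
        grow : ∀ {j} → Chain (suc j) → (fuel : ℕ) → N ≤ j + fuel → Σ[ d ∈ ℕ ] Enumeration d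
        grow {j} c fuel N≤ with covers? (suc j)
        ... | inj₁ covered = suc j , record { out = Chain.out c ; covers = covered }
        ... | inj₂ (u , x⟶u , new) with chain-extend c x⟶u new | fuel
        ...   | c′ | zero = contradiction (ℕ.≤-trans (ℕ.n≤1+n _) (ℕ.≤-trans (chain-bound c′) N≤j)) ℕ.1+n≰n
          where
            N≤j : N ≤ j
            N≤j = ℕ.≤-trans N≤ (ℕ.≤-reflexive (ℕ.+-identityʳ j))
        ...   | c′ | suc fuel′ = grow c′ fuel′ (≡.subst (N ≤_) (ℕ.+-suc j fuel′) N≤)

  abstract
    deg : Fin N → ℕ
    deg x = proj₁ (OutNeighbours.enumeration x)

    ⟶next^ : ∀ {x m} → 0 < m → m ≤ deg x → x ⟶ next^ m x
    ⟶next^ {x} {suc l} _ = OutNeighbours.Enumeration.out (proj₂ (OutNeighbours.enumeration x))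

    ⟶⇒next^ : ∀ {x u} → x ⟶ u → Σ[ m ∈ ℕ ] (0 < m × m ≤ deg x × next^ m x ≡ u)
    ⟶⇒next^ {x} x⟶u with OutNeighbours.Enumeration.covers (proj₂ (OutNeighbours.enumeration x)) x⟶u
    ... | l , l<d , e = suc l , s≤s z≤n , l<d , e

  deg-pos : ∀ x → 0 < deg x
  deg-pos x with ⟶⇒next^ (proj₂ (has-out x))
  ... | m , 0<m , m≤d , _ = ℕ.<-≤-trans 0<m m≤d

  module _ (no-clone : ∀ v w → ¬ Clone a v w) where

    -- If next x had smaller out-degree, x and next x would be clones.
    deg-≤-next : ∀ x → deg x ≤ deg (next x)
    deg-≤-next x with deg x ℕ.≤? deg (next x)
    ... | yes ≤ = ≤
    ... | no ≰ =
      contradiction (⟶next x , λ u _ u≢nx → Bool.⇔→≡ (mk⇔ (from-x u≢nx) from-next)) (no-clone x (next x))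
      where
        from-x : ∀ {u} → u ≢ next x → x ⟶ u → next x ⟶ u
        from-x u≢nx x⟶u with next-first x⟶u
        ... | inj₁ u≡nx = contradiction u≡nx u≢nx
        ... | inj₂ nx⟶u = nx⟶u
        from-next : ∀ {u} → next x ⟶ u → x ⟶ u
        from-next nx⟶u with ⟶⇒next^ nx⟶u
        ... | m , _ , m≤d , e = ≡.subst (x ⟶_) (trans (sym (next^-next m x)) e)
                                  (⟶next^ (s≤s z≤n) (ℕ.≤-trans (s≤s m≤d) (ℕ.≰⇒> ≰)))

    deg-mono : ∀ x {i j} → i ≤ j → deg (next^ i x) ≤ deg (next^ j x)
    deg-mono x {i} {zero} z≤n = ℕ.≤-refl
    deg-mono x {i} {suc j} i≤1+j with ℕ.m≤n⇒m<n∨m≡n i≤1+j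
    ... | inj₁ i<1+j = ℕ.≤-trans (deg-mono x (ℕ.≤-pred i<1+j)) (deg-≤-next (next^ j x))
    ... | inj₂ refl = ℕ.≤-refl

    module Orbit (y₀ : Fin N) where

      D : ℕ
      D = deg y₀

      P : ℕ
      P = suc (2 * D)

      y : ℕ → Fin N
      y i = next^ i y₀

      y-+ : ∀ m i → next^ m (y i) ≡ y (m + i)
      y-+ m i = sym (next^-+ m i y₀)

      D≤deg : ∀ i → D ≤ deg (y i)
      D≤deg i = deg-mono y₀ {0} {i} z≤n

      y⟶y : ∀ {i m} → 0 < m → m ≤ D → y i ⟶ y (m + i)
      y⟶y {i} {m} 0<m m≤D = ≡.subst (y i ⟶_) (y-+ m i) (⟶next^ 0<m (ℕ.≤-trans m≤D (D≤deg i)))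

      z : Fin N
      z = y (suc D)

      y₀-↛-z : ¬ y₀ ⟶ z
      y₀-↛-z y₀⟶z with ⟶⇒next^ y₀⟶z
      ... | m , 0<m , m≤D , ym≡z = ⟶-irrefl (≡.subst (y m ⟶_) back-to-ym (y⟶y (ℕ.m<n⇒0<n∸m (s≤s m≤D)) 1+D∸m≤D))
        where
          1+D∸m≤D : suc D ∸ m ≤ D
          1+D∸m≤D = ℕ.∸-monoʳ-≤ (suc D) 0<m
          back-to-ym : y (suc D ∸ m + m) ≡ y m
          back-to-ym = trans (cong y (ℕ.m∸n+n≡m (ℕ.m≤n⇒m≤1+n m≤D))) (sym ym≡z)

      z⟶y₀ : z ⟶ y₀
      z⟶y₀ = ¬⟶⇒⟵ y₀≢z y₀-↛-z
        where
          y₁⟶z : y 1 ⟶ z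
          y₁⟶z = ≡.subst (y 1 ⟶_) (cong y (ℕ.+-comm D 1)) (y⟶y (deg-pos y₀) ℕ.≤-refl)
          y₀≢z : y₀ ≢ z
          y₀≢z e = ⟶-asym (⟶next y₀) (≡.subst (y 1 ⟶_) (sym e) y₁⟶z)

      -- z returns to y₀ after exactly D steps, so the orbit of y₀ has length 2D+1.
      y-P : y P ≡ y₀
      y-P with ⟶⇒next^ z⟶y₀
      ... | m , _ , m≤deg-z , zm≡y₀ = trans (cong y P≡D+1+D) (≡.subst (λ l → y (l + suc D) ≡ y₀) m≡D y[m+1+D]≡y₀)
        where
          y[m+1+D]≡y₀ : y (m + suc D) ≡ y₀
          y[m+1+D]≡y₀ = trans (sym (y-+ m (suc D))) zm≡y₀

          m≤D : m ≤ D
          m≤D = ℕ.≤-trans m≤deg-z (≡.subst (λ v → deg z ≤ deg v) y[m+1+D]≡y₀ (deg-mono y₀ (ℕ.m≤n+m (suc D) m)))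

          m≡D : m ≡ D
          m≡D with m ℕ.<? D
          ... | no m≮D = ℕ.≤-antisym m≤D (ℕ.≮⇒≥ m≮D)
          ... | yes m<D = contradiction (⟶next^ (s≤s z≤n) m<D) (⟶-asym y[1+m]⟶y₀)
            where
              y[1+m]⟶y₀ : y (suc m) ⟶ y₀
              y[1+m]⟶y₀ = ≡.subst (y (suc m) ⟶_)
                (trans (cong y (trans (ℕ.+-comm D (suc m)) (sym (ℕ.+-suc m D)))) y[m+1+D]≡y₀)
                (y⟶y (deg-pos y₀) ℕ.≤-refl)

          P≡D+1+D : P ≡ D + suc D
          P≡D+1+D = trans (cong (λ l → suc (D + l)) (ℕ.+-identityʳ D)) (sym (ℕ.+-suc D D))

      y-wrap : ∀ i → y (i + P) ≡ y i
      y-wrap i = trans (sym (y-+ i P)) (cong (next^ i) y-P)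

      reaches-y₀ : ∀ n u → next^ n u ≡ y₀ → Σ[ r ∈ ℕ ] (r < P × y r ≡ u)
      reaches-y₀ zero u u≡y₀ = 0 , s≤s z≤n , sym u≡y₀
      reaches-y₀ (suc n) u e with reaches-y₀ n (next u) (trans (next^-next n u) e)
      ... | zero , _ , y₀≡next-u = 2 * D , ℕ.≤-refl , next-injective (trans y-P y₀≡next-u)
      ... | suc r , 1+r<P , y[1+r]≡next-u = r , ℕ.<-trans (ℕ.n<1+n r) 1+r<P , next-injective y[1+r]≡next-u

      orbit : ∀ u → Σ[ r ∈ ℕ ] (r < P × y r ≡ u)
      orbit u with y₀ ≟ u | y₀ ⟶? u
      ... | yes refl | _ = 0 , s≤s z≤n , refl
      ... | no _ | yes y₀⟶u with ⟶⇒next^ y₀⟶u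
      ...   | m , _ , m≤D , e = m , s≤s (ℕ.≤-trans m≤D (ℕ.m≤m+n D (D + 0))) , e
      orbit u | no y₀≢u | no ¬y₀⟶u with ⟶⇒next^ (¬⟶⇒⟵ y₀≢u ¬y₀⟶u)
      ... | m , _ , _ , e = reaches-y₀ m u e

      period : ∀ u → next^ P u ≡ u
      period u with orbit u
      ... | r , _ , refl = trans (y-+ P r) (trans (cong y (ℕ.+-comm P r)) (y-wrap r))

      deg-const : ∀ u → deg u ≡ D
      deg-const u with orbit u
      ... | r , r<P , refl = ℕ.≤-antisym (≡.subst (λ v → deg (y r) ≤ deg v) y-P (deg-mono y₀ (ℕ.<⇒≤ r<P))) (D≤deg r)

      ⟶next^-≤D : ∀ {u m} → 0 < m → m ≤ D → u ⟶ next^ m u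
      ⟶next^-≤D {u} 0<m m≤D = ⟶next^ 0<m (≡.subst (_ ≤_) (sym (deg-const u)) m≤D)

      complement : ∀ {m} u → m ≤ P → next^ (P ∸ m) (next^ m u) ≡ u
      complement {m} u m≤P = begin
        next^ (P ∸ m) (next^ m u)  ≡⟨ sym (next^-+ (P ∸ m) m u) ⟩
        next^ (P ∸ m + m) u        ≡⟨ cong (λ l → next^ l u) (ℕ.m∸n+n≡m m≤P) ⟩
        next^ P u                  ≡⟨ period u ⟩
        u                          ∎
        where open ≡-Reasoning

      P∸-≤D : ∀ {m} → D < m → P ∸ m ≤ D
      P∸-≤D D<m = ℕ.≤-trans (ℕ.∸-monoʳ-≤ P D<m) (ℕ.≤-reflexive (trans (ℕ.m+n∸m≡n D (D + 0)) (ℕ.+-identityʳ D)))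

      -- m steps forward are P ∸ m ≤ D steps backward.
      ⟵next^ : ∀ {u m} → D < m → m < P → next^ m u ⟶ u
      ⟵next^ {u} {m} D<m m<P =
        ≡.subst (next^ m u ⟶_) (complement u (ℕ.<⇒≤ m<P)) (⟶next^-≤D (ℕ.m<n⇒0<n∸m m<P) (P∸-≤D D<m))

      next^-≢ : ∀ {u m} → 0 < m → m < P → next^ m u ≢ u
      next^-≢ {u} {m} 0<m m<P with m ℕ.≤? D
      ... | yes m≤D = ⟶⇒≢ (⟶next^-≤D 0<m m≤D) ∘ sym
      ... | no m≰D = ⟶⇒≢ (⟵next^ (ℕ.≰⇒> m≰D) m<P)

      y-distinct : ∀ {i j} → i < j → j < P → y i ≢ y j
      y-distinct {i} {j} i<j j<P yi≡yj =
        next^-≢ (ℕ.m<n⇒0<n∸m i<j) (ℕ.≤-<-trans (ℕ.m∸n≤m j i) j<P) (trans y-shift (sym yi≡yj))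
        where
          y-shift : next^ (j ∸ i) (y i) ≡ y j
          y-shift = trans (y-+ (j ∸ i) i) (cong y (ℕ.m∸n+n≡m (ℕ.<⇒≤ i<j)))

      y-injective : ∀ {i j} → i < P → j < P → y i ≡ y j → i ≡ j
      y-injective {i} {j} i<P j<P yi≡yj with ℕ.<-cmp i j
      ... | tri< i<j _ _ = contradiction yi≡yj (y-distinct i<j j<P)
      ... | tri≈ _ i≡j _ = i≡j
      ... | tri> _ _ j<i = contradiction (sym yi≡yj) (y-distinct j<i i<P)

      label : Fin N → Fin P
      label u = fromℕ< (proj₁ (proj₂ (orbit u)))

      y-label : ∀ u → y (toℕ (label u)) ≡ u
      y-label u = trans (cong y (Fin.toℕ-fromℕ< (proj₁ (proj₂ (orbit u))))) (proj₂ (proj₂ (orbit u)))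

      label-injective : ∀ {u v} → label u ≡ label v → u ≡ v
      label-injective {u} {v} eq = trans (sym (y-label u)) (trans (cong (y ∘ toℕ) eq) (y-label v))

      label-y : ∀ i → label (y (toℕ i)) ≡ i
      label-y i =
        Fin.toℕ-injective (y-injective (Fin.toℕ<n (label (y (toℕ i)))) (Fin.toℕ<n i) (y-label (y (toℕ i))))

      steps⇒next^ : ∀ {u v d} → Steps P (toℕ (label u)) (toℕ (label v)) d → next^ d u ≡ v
      steps⇒next^ {u} {v} {d} (_ , lands) = begin
        next^ d u       ≡⟨ cong (next^ d) (sym (y-label u)) ⟩
        next^ d (y i)   ≡⟨ y-+ d i ⟩
        y (d + i)       ≡⟨ cong y (ℕ.+-comm d i) ⟩
        y (i + d)       ≡⟨ landing lands ⟩
        y j             ≡⟨ y-label v ⟩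
        v               ∎
        where
          open ≡-Reasoning
          i j : ℕ
          i = toℕ (label u)
          j = toℕ (label v)
          landing : i + d ≡ j ⊎ i + d ≡ j + P → y (i + d) ≡ y j
          landing (inj₁ e) = cong y e
          landing (inj₂ e) = trans (cong y e) (y-wrap j)

      adjacency : ∀ {u v} → u ≢ v → a u v ≡ Tadj D (label u) (label v)
      adjacency {u} {v} u≢v = by-cases (d ℕ.≤? D)
        where
          d : ℕ
          d = cdist D (label u) (label v)

          d<P : d < P
          d<P = proj₁ (cdist-steps D (label u) (label v))

          u-to-v : next^ d u ≡ v
          u-to-v = steps⇒next^ (cdist-steps D (label u) (label v))

          0<d : 0 < d
          0<d = ℕ.n≢0⇒n>0 λ d≡0 → u≢v (trans (cong (λ l → next^ l u) (sym d≡0)) u-to-v)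

          by-cases : Dec (d ≤ D) → a u v ≡ Tadj D (label u) (label v)
          by-cases (yes d≤D) =
            trans (≡.subst (u ⟶_) u-to-v (⟶next^-≤D 0<d d≤D))
                  (sym (Tadj-true {D} {label u} {label v} 0<d d≤D))
          by-cases (no d≰D) =
            trans (Bool.¬-not (⟶-asym (≡.subst (_⟶ u) u-to-v (⟵next^ (ℕ.≰⇒> d≰D) d<P))))
                  (sym (Tadj-false {D} {label u} {label v} (ℕ.≰⇒> d≰D)))

      decomposition : BlockDecomposition a
      decomposition = record
        { k = D
        ; block = just ∘ label
        ; across = λ { refl refl i≢j → adjacency (i≢j ∘ cong label) }
        ; above-bottom = λ _ ()
        ; inhabited = λ i → y (toℕ i) , cong just (label-y i)
        ; triangle-free = λ _ bx by _ (x⟶y , _) →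
            ⟶⇒≢ x⟶y (label-injective (Maybe.just-injective (trans bx (sym by))))
        }

has-out? : ∀ {N} (a : Fin N → Fin N → Bool) x → Dec (∃ λ u → finDigraph N a ⊢ x ⟶ u)
has-out? a x = Fin.any? (λ u → a x u Bool.≟ true)

sink-or-out : ∀ {N} (a : Fin N → Fin N → Bool) →
  (∃ λ w → ∀ u → ¬ finDigraph N a ⊢ w ⟶ u) ⊎ (∀ x → ∃ λ u → finDigraph N a ⊢ x ⟶ u)
sink-or-out {N} a with Fin.all? (has-out? a)
... | yes out = inj₂ out
... | no ¬out with Fin.¬∀⟶∃¬ N _ (has-out? a) ¬out
...   | w , no-out = inj₁ (w , λ u w⟶u → no-out (u , w⟶u))

Clone? : ∀ {N} (a : Fin N → Fin N → Bool) v w → Dec (Clone a v w)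
Clone? a v w =
  (a v w Bool.≟ true) ×-dec Fin.all? (λ u → ¬? (u ≟ v) →-dec ¬? (u ≟ w) →-dec (a v u Bool.≟ a w u))

clone? : ∀ {N} (a : Fin N → Fin N → Bool) → (∃ λ v → ∃ λ w → Clone a v w) ⊎ (∀ v w → ¬ Clone a v w)
clone? a with Fin.any? (λ v → Fin.any? (Clone? a v))
... | yes found = inj₁ found
... | no none = inj₂ λ v w c → none (v , w , c)

decompose : ∀ M (a : Fin (suc M) → Fin (suc M) → Bool) →
  IsTournament (finDigraph (suc M) a) → D4Free (finDigraph (suc M) a) → BlockDecomposition a
decompose zero a isT _ = record
  { k = 0
  ; block = λ _ → just zero
  ; across = λ { {i = zero} {zero} _ _ 0≢0 → contradiction refl 0≢0 }
  ; above-bottom = λ _ ()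
  ; inhabited = λ { zero → zero , refl }
  ; triangle-free = λ { _ {zero} {zero} _ _ _ (x⟶x , _) → Tournament.⟶-irrefl isT x⟶x }
  }
decompose (suc M) a isT d4 with sink-or-out a
... | inj₁ (w , w-sink) =
  Extension.add-sink isT w w-sink (decompose M _ (Extension.isT₋ isT w) (on-D4Free (punchIn w) d4))
... | inj₂ has-out with clone? a
...   | inj₁ (_ , w , clone) =
  Extension.add-clone isT w clone (decompose M _ (Extension.isT₋ isT w) (on-D4Free (punchIn w) d4))
...   | inj₂ no-clone = Circulant.Orbit.decomposition isT d4 has-out no-clone zero

corollary3p9 : (N : ℕ) (a : Fin N → Fin N → Bool) →
    IsTournament (finDigraph N a) → 1 ≤ N →
    ((¬ HasSubIso (finDigraph N a) D4)
      ⇔ (Σ[ k ∈ ℕ ] Σ[ I ∈ (Fin (suc (2 * k)) → Digraph) ]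
          ((∀ i → TransitiveTournament (I i)) ×
           ((finDigraph N a ≅ TSubst k I)
             ⊎ Σ[ J ∈ Digraph ]
                 (TransitiveTournament J × (finDigraph N a ≅ I2Subst (TSubst k I) J))))))
corollary3p9 (suc M) a isT _ = mk⇔
  (λ ¬D4 → BlockDecomposition⇒TnBlowUp isT (decompose M a isT (Equivalence.to D4-free ¬D4)))
  (Equivalence.from D4-free ∘ TnBlowUp⇒D4Free)
  where
    D4-free : (¬ HasSubIso (finDigraph (suc M) a) D4) ⇔ D4Free (finDigraph (suc M) a)
    D4-free = ¬HasSubIso-D4⇔D4Free isT
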